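{- Let $(b_n)_{n\ge 0}$ be given by $b_n=2^n+2$. Fix $k\in\mathbb{N}^+=\{1,2,\dots\}$ and let $\phi_k$ be an unsatisfiable boolean formula in conjunctive normal form with $n$ clauses, each containing exactly $b_k$ terms, no clause containing the same terminal more than once. For $j=k,k-1,\dots,1$ define $\phi_{j-1}$ from $\phi_j$ as follows: for the $i$-th clause $c$ of $\phi_j$ with terms $a_1,\dots,a_{b_j}$ (in order), introduce a new terminal $x_i$ not appearing in $\phi_j$ (distinct for distinct $i$) and form the two clauses $(a_1\lor\cdots\lor a_{b_j/2}\lor x_i)$ and $(a_{b_j/2+1}\lor\cdots\lor a_{b_j}\lor\overline{x_i})$; $\phi_{j-1}$ is the conjunction of all clauses so formed. The resulting $\phi_0$ is a 3CNF formula. Then Quigley's algorithm, run on input $\phi_0$, outputs ``satisfiable''. Consequently (as $\phi_0$ is unsatisfiable) Quigley's algorithm gives an incorrect answer on $\phi_0$.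
   Context: A terminal is a boolean variable; a term is a terminal $t$ or its negation $\overline{t}$. A clause is a disjunction of terms, treated as a set of terms (order irrelevant, no duplicate terms); its length is its number of terms. An instance is a conjunction of clauses (a set of clauses). Clauses containing both $t$ and $\overline{t}$ for some terminal $t$ are never stored. Resolution (Quigley's Lemma 5.9): if clauses $C$ and $D$ contain a terminal $t$ that is positive in one and negated in the other, they imply the clause consisting of all terms of $C$ and $D$ except those containing $t$ (each shared term appearing once). The clauses "implied by $C$ and $D$" are all clauses obtained this way, for every such terminal $t$. Expansion (Quigley's Lemma 5.8): a clause $C$ and a terminal $t$ of the instance not occurring in $C$ imply the clauses $C\lor t$ and $C\lor\overline{t}$; iterating, "expanding $C$ to length at most 3" yields all clauses of length at most $3$ that contain all terms of $C$ plus additional terms on terminals of the instance not in $C$. Quigley's algorithm (on an instance): repeat the following round. (1) Let $L$ be an empty list. For each clause $C$ of length at most $3$ currently in the instance: for each clause $D$ of length at most $3$ currently in the instance, append to $L$ every clause of length at most $3$ implied by $C$ and $D$ by resolution that contains no complementary pair of terms and is not already in the instance; then append to $L$ all clauses obtained by expanding $C$ to length at most $3$. (Clauses of length $\ge 4$ are never added.) After all pairs are processed, add each clause of $L$ not already in the instance to the instance (so clauses produced in a round are only used from the next round on). (2) If the instance contains two length-$1$ clauses $\{t\}$ and $\{\overline{t}\}$ for some terminal $t$, output ``unsatisfiable'' and stop. (3) If no new clause was added in this round, output ``satisfiable'' and stop; otherwise start a new round. -}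

module Defs where

open import Data.Nat using (ℕ; zero; suc; _+_; _^_; _≤_; _<_; _∸_)
open import Data.Nat.DivMod using (_/_)
open import Data.Bool using (Bool; true; false; not)
open import Data.Product using (Σ; ∃; ∃-syntax; _×_; _,_; proj₁; proj₂)
open import Data.Sum using (_⊎_)
open import Data.List using (List; []; _∷_; _++_; take; drop; length; map; [_])
open import Data.List.Membership.Propositional using (_∈_; _∉_)
open import Data.List.Relation.Unary.All using (All)
open import Data.List.Relation.Unary.Any using (Any)
open import Data.List.Relation.Unary.Unique.Propositional using (Unique)
open import Relation.Binary.PropositionalEquality using (_≡_; _≢_)
open import Relation.Nullary using (¬_)
open import Function.Bundles using (_⇔_)

Terminal : Set
Terminal = ℕ

-- A term is a terminal with a polarity: (t , true) is t, (t , false) is ¬t.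
Term : Set
Term = Terminal × Bool

-- A clause is a list of terms (read as the set of its members; all clauses
-- stored in an instance below are duplicate-free, so length = cardinality).
Clause : Set
Clause = List Term

-- A CNF formula as a list of clauses (order matters for the splitting).
CNF : Set
CNF = List Clause

b : ℕ → ℕ
b n = 2 ^ n + 2

OccursIn : Terminal → Clause → Set
OccursIn t c = Any (λ u → t ≡ proj₁ u) c

OccursInCNF : Terminal → CNF → Set
OccursInCNF t φ = Any (OccursIn t) φ

Satisfies : (ℕ → Bool) → CNF → Set
Satisfies σ φ = All (λ c → Any (λ u → σ (proj₁ u) ≡ proj₂ u) c) φ

Unsatisfiable : CNF → Set
Unsatisfiable φ = ∀ (σ : ℕ → Bool) → ¬ Satisfies σ φ

splitClause : ℕ → Terminal → Clause → CNF
splitClause h x c = (take h c ++ [ (x , true) ]) ∷ (drop h c ++ [ (x , false) ]) ∷ []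

splitAllFrom : ℕ → ℕ → (ℕ → Terminal) → CNF → CNF
splitAllFrom h i x [] = []
splitAllFrom h i x (c ∷ φ) = splitClause h (x i) c ++ splitAllFrom h (suc i) x φ

Step : ℕ → CNF → CNF → Set
Step j φ ψ =
  Σ (ℕ → Terminal) λ x →
      (∀ i → i < length φ → ¬ OccursInCNF (x i) φ)
    × (∀ i i' → i < length φ → i' < length φ → x i ≡ x i' → i ≡ i')
    × ψ ≡ splitAllFrom (b j / 2) 0 x φ

Chain : ℕ → CNF → CNF → Set
Chain zero φ ψ = φ ≡ ψ
Chain (suc j) φ ψ = Σ CNF λ φ' → Step (suc j) φ φ' × Chain j φ' ψ

ClauseSet : Set₁
ClauseSet = Clause → Set

NonTaut : Clause → Set
NonTaut c = ¬ (Σ Terminal λ t → ((t , true) ∈ c) × ((t , false) ∈ c))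

WF : Clause → Set
WF c = Unique c × NonTaut c

_≈ᶜ_ : Clause → Clause → Set
c ≈ᶜ d = ∀ u → (u ∈ c) ⇔ (u ∈ d)

OccursInSet : Terminal → ClauseSet → Set
OccursInSet t S = Σ Clause λ d → S d × OccursIn t d

Resolvent : Clause → Clause → Clause → Set
Resolvent C D E =
  Σ Terminal λ t → Σ Bool λ s →
      ((t , s) ∈ C) × ((t , not s) ∈ D)
    × (∀ u → (u ∈ E) ⇔ (((u ∈ C) ⊎ (u ∈ D)) × (proj₁ u ≢ t)))

Expansion : ClauseSet → Clause → Clause → Set
Expansion S C E =
    (∀ u → u ∈ C → u ∈ E)
  × (∀ u → u ∈ E → u ∉ C → OccursInSet (proj₁ u) S × ¬ OccursIn (proj₁ u) C)

Produced : ClauseSet → ClauseSet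
Produced S E =
  WF E × length E ≤ 3 ×
  ( (Σ Clause λ C → Σ Clause λ D →
        S C × length C ≤ 3 × S D × length D ≤ 3 × Resolvent C D E)
  ⊎ (Σ Clause λ C → S C × length C ≤ 3 × Expansion S C E) )

Round : CNF → ℕ → ClauseSet
Round φ zero E = WF E × Any (λ c → c ≈ᶜ E) φ
Round φ (suc r) E = Round φ r E ⊎ Produced (Round φ r) E

Contradictory : ClauseSet → Set
Contradictory S = Σ Terminal λ t → S ((t , true) ∷ []) × S ((t , false) ∷ [])

-- Quigley's algorithm outputs "satisfiable" on φ: some round r+1 adds no new
-- clause and no round 1, ..., r+1 produced a contradictory pair of units.
-- (Round r+1 is then the halting round, since after it stopped on the first
-- round adding nothing without a contradiction in any round up to it.)
QuigleyOutputsSatisfiable : CNF → Set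
QuigleyOutputsSatisfiable φ =
  Σ ℕ λ r →
      (∀ E → Round φ (suc r) E → Round φ r E)
    × (∀ r' → r' ≤ r → ¬ Contradictory (Round φ (suc r')))

{-# OPTIONS --safe #-}
module Submission where

-- Only the last splitting step matters; the earlier ones just keep clause lengths b_j and
-- the terminals within each clause distinct.  The last one turns each 4-clause a₁ ∨ a₂ ∨ a₃ ∨ a₄
-- of φ₁ into a₁ ∨ a₂ ∨ x and a₃ ∨ a₄ ∨ ¬x with x fresh, so every clause of φ₀ has three terms on
-- distinct terminals, a fresh term lies in exactly one clause, and two clauses sharing a fresh
-- terminal share no original one.  Two such 3-clauses have a resolvent of length ≤ 3 only if they
-- share a term besides the pivot; hence round 1 adds only the merged clauses u ∨ Y ∨ Z (Y, Z
-- fresh) resolved from t ∨ u ∨ Y and ¬t ∨ u ∨ Z, and no expansion of a 3-clause is new.  In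
-- round 2 a merged clause never shares a term with a clause it clashes with, so round 2 only
-- repeats round 1 and no unit clause ever appears: the algorithm answers "satisfiable",
-- although splitting preserves unsatisfiability.

open import Defs
open import Data.Bool using (Bool; true; false; not)
open import Data.Bool.Properties using (not-involutive; not-¬; ¬-not) renaming (_≟_ to _≟ᴮ_)
open import Data.Empty using (⊥; ⊥-elim)
open import Data.Fin using (Fin; zero; suc; toℕ)
open import Data.Fin.Properties using (injective⇒≤; toℕ-injective; toℕ<n)
open import Data.List using (List; []; _∷_; _++_; [_]; take; drop; length; lookup; map)
open import Data.List.Membership.Propositional using (_∈_; find; lose)
open import Data.List.Membership.Propositional.Properties using (∈-lookup; ∈-map⁺)
open import Data.List.Properties using (length-++; length-take; length-drop; take-map; drop-map; map-++; take++drop≡id)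
open import Data.List.Relation.Binary.Subset.Propositional using (_⊆_)
open import Data.List.Relation.Binary.Subset.Propositional.Properties using (xs⊆xs++ys; xs⊆ys++xs; Any-resp-⊆)
open import Data.List.Relation.Unary.All as All using (All; []; _∷_)
open import Data.List.Relation.Unary.AllPairs using ([]; _∷_)
open import Data.List.Relation.Unary.Any as Any using (Any; here; there; any?)
open import Data.List.Relation.Unary.Any.Properties using (lookup-index; ++⁻) renaming (map⁻ to Any-map⁻)
open import Data.List.Relation.Unary.Unique.Propositional using (Unique)
open import Data.List.Relation.Unary.Unique.Propositional.Properties using (++⁺; take⁺; drop⁺) renaming (map⁻ to Unique-map⁻)
open import Data.Nat using (ℕ; zero; suc; _+_; _*_; _∸_; _⊓_; _^_; _≤_; _<_; s≤s)
import Data.Nat as ℕ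
open import Data.Nat.Properties using (<⇒≱; ≤-reflexive; m≤n⇒m⊓n≡m; m≤m+n; m+n∸m≡n; +-suc)
open import Data.Nat.DivMod using (_/_; m*n/n≡m)
open import Data.Nat.Tactic.RingSolver using (solve-∀)
open import Data.Product as Product using (∃-syntax; _×_; _,_; proj₁; proj₂; uncurry)
open import Data.Product.Properties using (≡-dec)
open import Data.Sum as Sum using (_⊎_; inj₁; inj₂; [_,_]′)
open import Function.Bundles using (Equivalence; _⇔_; mk⇔)
open import Function.Definitions using (Injective)
import Function.Properties.Equivalence as ⇔
open import Relation.Binary.Definitions using (DecidableEquality)
open import Relation.Binary.PropositionalEquality using (_≡_; _≢_; refl; sym; trans; cong; cong₂; subst; ≢-sym; module ≡-Reasoning)
open import Relation.Nullary using (¬_; yes; no; contradiction)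
open import Relation.Unary using (Decidable)

module _ {A : Set} where

  lookup-injective : ∀ {xs : List A} → Unique xs → ∀ i j → lookup xs i ≡ lookup xs j → i ≡ j
  lookup-injective (_ ∷ _)     zero    zero    _  = refl
  lookup-injective (x≢xs ∷ _)  zero    (suc j) eq = contradiction eq (All.lookup x≢xs (∈-lookup j))
  lookup-injective (x≢xs ∷ _)  (suc i) zero    eq = contradiction (sym eq) (All.lookup x≢xs (∈-lookup i))
  lookup-injective (_ ∷ uxs)   (suc i) (suc j) eq = cong suc (lookup-injective uxs i j eq)

  unique-⊆⇒length≤ : ∀ {xs ys : List A} → Unique xs → xs ⊆ ys → length xs ≤ length ys
  unique-⊆⇒length≤ {xs} {ys} uxs xs⊆ys = injective⇒≤ position-injective
    where
    position : Fin (length xs) → Fin (length ys)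
    position i = Any.index (xs⊆ys (∈-lookup i))

    position-injective : Injective _≡_ _≡_ position
    position-injective {i} {j} eq = lookup-injective uxs i j (begin
      lookup xs i            ≡⟨ lookup-index (xs⊆ys (∈-lookup i)) ⟩
      lookup ys (position i) ≡⟨ cong (lookup ys) eq ⟩
      lookup ys (position j) ≡⟨ lookup-index (xs⊆ys (∈-lookup j)) ⟨
      lookup xs j            ∎)
      where open ≡-Reasoning

  module _ (_≟_ : DecidableEquality A) where
    open import Data.List.Membership.DecPropositional _≟_ using (_∈?_)

    common-member : ∀ {xs ys zs : List A} → Unique xs → Unique ys → xs ⊆ zs → ys ⊆ zs →
                    length zs < length xs + length ys → ∃[ w ] w ∈ xs × w ∈ ys
    common-member {xs} {ys} {zs} uxs uys xs⊆zs ys⊆zs short with any? (_∈? ys) xs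
    ... | yes some = find some
    ... | no none  = contradiction (subst (_≤ length zs) (length-++ xs) long) (<⇒≱ short)
      where
      long : length (xs ++ ys) ≤ length zs
      long = unique-⊆⇒length≤ (++⁺ uxs uys (λ (w∈xs , w∈ys) → none (lose w∈xs w∈ys)))
                           (λ w∈ → [ xs⊆zs , ys⊆zs ]′ (++⁻ xs w∈))

_≟ᵗ_ : DecidableEquality Term
_≟ᵗ_ = ≡-dec ℕ._≟_ _≟ᴮ_

≈ᶜ⇒⊆ : ∀ {c d} → c ≈ᶜ d → c ⊆ d
≈ᶜ⇒⊆ c≈d {u} = Equivalence.to (c≈d u)

≈ᶜ⇒⊇ : ∀ {c d} → c ≈ᶜ d → d ⊆ c
≈ᶜ⇒⊇ c≈d {u} = Equivalence.from (c≈d u)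

≈ᶜ-sym : ∀ {c d} → c ≈ᶜ d → d ≈ᶜ c
≈ᶜ-sym c≈d u = ⇔.sym (c≈d u)

≈ᶜ-trans : ∀ {c d e} → c ≈ᶜ d → d ≈ᶜ e → c ≈ᶜ e
≈ᶜ-trans c≈d d≈e u = ⇔.trans (c≈d u) (d≈e u)

unique-⊆⇒≈ᶜ : ∀ {xs E} → Unique xs → xs ⊆ E → length E ≤ length xs → E ≈ᶜ xs
unique-⊆⇒≈ᶜ {xs} {E} uxs xs⊆E short u = mk⇔ member xs⊆E
  where
  member : u ∈ E → u ∈ xs
  member u∈E with common-member _≟ᵗ_ ([] ∷ []) uxs (λ { (here refl) → u∈E }) xs⊆E (s≤s short)
  ... | _ , here refl , u∈xs = u∈xs

occurs : ∀ {u c} → u ∈ c → OccursIn (proj₁ u) c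
occurs = Any.map (cong proj₁)

DistinctTerminals : Clause → Set
DistinctTerminals c = Unique (map proj₁ c)

terminal-injective : ∀ {c v w} → DistinctTerminals c → v ∈ c → w ∈ c → proj₁ v ≡ proj₁ w → v ≡ w
terminal-injective _          (here refl) (here refl) _ = refl
terminal-injective (v≢c ∷ _)  (here refl) (there w∈c) e =
  contradiction e (All.lookup v≢c (∈-map⁺ proj₁ w∈c))
terminal-injective (w≢c ∷ _)  (there v∈c) (here refl) e =
  contradiction (sym e) (All.lookup w≢c (∈-map⁺ proj₁ v∈c))
terminal-injective (_ ∷ dist) (there v∈c) (there w∈c) e = terminal-injective dist v∈c w∈c e

distinct-terminals⇒nonclashing : ∀ {c t s} → DistinctTerminals c → (t , s) ∈ c → (t , not s) ∈ c → ⊥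
distinct-terminals⇒nonclashing dist ts∈c tns∈c =
  not-¬ refl (cong proj₂ (terminal-injective dist ts∈c tns∈c refl))

ThreeTerminals : Clause → Set
ThreeTerminals E = ∃[ x ] ∃[ y ] ∃[ z ] E ≈ᶜ (x ∷ y ∷ z ∷ []) × DistinctTerminals (x ∷ y ∷ z ∷ [])

ThreeTerminals-≈ᶜ : ∀ {C E} → C ≈ᶜ E → ThreeTerminals C → ThreeTerminals E
ThreeTerminals-≈ᶜ C≈E (x , y , z , C≈ , dist) = x , y , z , ≈ᶜ-trans (≈ᶜ-sym C≈E) C≈ , dist

length≡3⇒ThreeTerminals : ∀ {c} → length c ≡ 3 → DistinctTerminals c → ThreeTerminals c
length≡3⇒ThreeTerminals {x ∷ y ∷ z ∷ []} refl dist = x , y , z , (λ _ → ⇔.refl) , dist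

¬ThreeTerminals-unit : ∀ {u} → ¬ ThreeTerminals (u ∷ [])
¬ThreeTerminals-unit (x , y , z , E≈ , ((x≢y ∷ _) ∷ _))
  with ≈ᶜ⇒⊇ E≈ (here refl) | ≈ᶜ⇒⊇ E≈ (there (here refl))
... | here refl | here refl = x≢y refl

TwoBesides : Clause → Terminal → Set
TwoBesides C p =
  ∃[ y ] ∃[ z ] (y ∷ z ∷ [] ⊆ C) × Unique (y ∷ z ∷ []) × All (λ w → proj₁ w ≢ p) (y ∷ z ∷ [])

two-besides : ∀ {C xs a b p} → C ≈ᶜ xs → a ∈ xs → b ∈ xs →
              proj₁ a ≢ proj₁ b → proj₁ a ≢ p → proj₁ b ≢ p → TwoBesides C p
two-besides {a = a} {b} C≈ a∈ b∈ a≢b a≢p b≢p =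
  a , b , (λ { (here refl) → ≈ᶜ⇒⊇ C≈ a∈ ; (there (here refl)) → ≈ᶜ⇒⊇ C≈ b∈ }) ,
  ((λ e → a≢b (cong proj₁ e)) ∷ []) ∷ [] ∷ [] , a≢p ∷ b≢p ∷ []

ThreeTerminals⇒TwoBesides : ∀ {C p σ} → ThreeTerminals C → (p , σ) ∈ C → TwoBesides C p
ThreeTerminals⇒TwoBesides (x , y , z , C≈ , (x≢y ∷ x≢z ∷ []) ∷ (y≢z ∷ []) ∷ [] ∷ []) p∈C
  with ≈ᶜ⇒⊆ C≈ p∈C
... | here refl =
  two-besides C≈ (there (here refl)) (there (there (here refl))) y≢z (≢-sym x≢y) (≢-sym x≢z)
... | there (here refl) =
  two-besides C≈ (here refl) (there (there (here refl))) x≢z x≢y (≢-sym y≢z)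
... | there (there (here refl)) =
  two-besides C≈ (here refl) (there (here refl)) x≢y x≢z y≢z

resolvent⊇ : ∀ {C D E} (res : Resolvent C D E) {v} → v ∈ C ⊎ v ∈ D → proj₁ v ≢ proj₁ res → v ∈ E
resolvent⊇ (_ , _ , _ , _ , E⇔) v∈ v≢t = Equivalence.from (E⇔ _) (v∈ , v≢t)

resolvent⊆ : ∀ {C D E} (res : Resolvent C D E) {v} → v ∈ E → (v ∈ C ⊎ v ∈ D) × proj₁ v ≢ proj₁ res
resolvent⊆ (_ , _ , _ , _ , E⇔) v∈E = Equivalence.to (E⇔ _) v∈E

short-resolvent⇒common-term : ∀ {C D E} → ThreeTerminals C → ThreeTerminals D →
  (res : Resolvent C D E) → length E ≤ 3 → ∃[ w ] w ∈ C × w ∈ D × proj₁ w ≢ proj₁ res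
short-resolvent⇒common-term threeC threeD res@(_ , _ , t∈C , t∈D , _) short
  with ThreeTerminals⇒TwoBesides threeC t∈C | ThreeTerminals⇒TwoBesides threeD t∈D
... | y₁ , y₂ , ys⊆C , uys , ys≢t | z₁ , z₂ , zs⊆D , uzs , zs≢t
  with common-member _≟ᵗ_ uys uzs (λ m → resolvent⊇ res (inj₁ (ys⊆C m)) (All.lookup ys≢t m))
                                  (λ m → resolvent⊇ res (inj₂ (zs⊆D m)) (All.lookup zs≢t m)) (s≤s short)
... | w , w∈ys , w∈zs = w , ys⊆C w∈ys , zs⊆D w∈zs , All.lookup ys≢t w∈ys

expansion-trivial : ∀ {S C E} → ThreeTerminals C → Expansion S C E → length E ≤ 3 → C ≈ᶜ E
expansion-trivial (x , y , z , C≈ , dist) (C⊆E , _) short =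
  ≈ᶜ-trans C≈ (≈ᶜ-sym (unique-⊆⇒≈ᶜ (Unique-map⁻ dist) (λ m → C⊆E _ (≈ᶜ⇒⊇ C≈ m)) short))

Round⇒WF : ∀ {φ} r {E} → Round φ r E → WF E
Round⇒WF zero    (wf , _)       = wf
Round⇒WF (suc r) (inj₁ E∈)      = Round⇒WF r E∈
Round⇒WF (suc r) (inj₂ (wf , _)) = wf

Resolvent-≈ᶜ : ∀ {C D E E′} → Resolvent C D E → E ≈ᶜ E′ → Resolvent C D E′
Resolvent-≈ᶜ (t , s , t∈C , t∈D , E⇔) E≈E′ =
  t , s , t∈C , t∈D , λ u → ⇔.trans (⇔.sym (E≈E′ u)) (E⇔ u)

Resolvent-≈ᶜ-parents : ∀ {C C′ D D′ E} → C′ ≈ᶜ C → D′ ≈ᶜ D → Resolvent C D E → Resolvent C′ D′ E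
Resolvent-≈ᶜ-parents C′≈C D′≈D (t , s , t∈C , t∈D , E⇔) =
  t , s , ≈ᶜ⇒⊇ C′≈C t∈C , ≈ᶜ⇒⊇ D′≈D t∈D ,
  λ u → ⇔.trans (E⇔ u) (mk⇔ (Product.map₁ (Sum.map (≈ᶜ⇒⊇ C′≈C) (≈ᶜ⇒⊇ D′≈D)))
                             (Product.map₁ (Sum.map (≈ᶜ⇒⊆ C′≈C) (≈ᶜ⇒⊆ D′≈D))))

Expansion-≈ᶜ : ∀ {S C E E′} → Expansion S C E → E ≈ᶜ E′ → Expansion S C E′
Expansion-≈ᶜ (C⊆E , new) E≈E′ =
  (λ u u∈C → ≈ᶜ⇒⊆ E≈E′ (C⊆E u u∈C)) , (λ u u∈E′ → new u (≈ᶜ⇒⊇ E≈E′ u∈E′))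

Round-≈ᶜ : ∀ {φ} r {C E} → Round φ r C → C ≈ᶜ E → WF E → length E ≤ 3 → Round φ r E
Round-≈ᶜ zero    (_ , c≈C)  C≈E wf _ = wf , Any.map (λ c≈ → ≈ᶜ-trans c≈ C≈E) c≈C
Round-≈ᶜ (suc r) (inj₁ C∈)  C≈E wf short = inj₁ (Round-≈ᶜ r C∈ C≈E wf short)
Round-≈ᶜ (suc r) (inj₂ (_ , _ , inj₁ (A , B , A∈ , lA , B∈ , lB , res))) C≈E wf short =
  inj₂ (wf , short , inj₁ (A , B , A∈ , lA , B∈ , lB , Resolvent-≈ᶜ res C≈E))
Round-≈ᶜ (suc r) (inj₂ (_ , _ , inj₂ (A , A∈ , lA , exp))) C≈E wf short =
  inj₂ (wf , short , inj₂ (A , A∈ , lA , Expansion-≈ᶜ exp C≈E))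

module QuigleyOnSplitClauses
  (ψ : CNF) (Original : Terminal → Set) (original? : Decidable Original)
  (three-terminal : ∀ {c} → c ∈ ψ → length c ≡ 3 × DistinctTerminals c)
  (fresh-member : ∀ {c} → c ∈ ψ → ∃[ Y ] Y ∈ c × ¬ Original (proj₁ Y))
  (fresh-home-unique : ∀ {c d Y} → c ∈ ψ → d ∈ ψ → ¬ Original (proj₁ Y) → Y ∈ c → Y ∈ d → c ≡ d)
  (siblings-disjoint : ∀ {c d t s v} → c ∈ ψ → d ∈ ψ → ¬ Original t → (t , s) ∈ c → (t , not s) ∈ d →
                       v ∈ c → Original (proj₁ v) → ¬ OccursIn (proj₁ v) d)
  where

  Fresh : Term → Set
  Fresh u = ¬ Original (proj₁ u)

  original≢fresh : ∀ {a b} → Original a → ¬ Original b → a ≢ b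
  original≢fresh oa fb a≡b = fb (subst Original a≡b oa)

  Home : Term → Clause → Set
  Home Y h = h ∈ ψ × Y ∈ h

  ψ-ThreeTerminals : ∀ {c} → c ∈ ψ → ThreeTerminals c
  ψ-ThreeTerminals c∈ψ = uncurry length≡3⇒ThreeTerminals (three-terminal c∈ψ)

  ψ-nonclashing : ∀ {c t s} → c ∈ ψ → (t , s) ∈ c → (t , not s) ∈ c → ⊥
  ψ-nonclashing c∈ψ = distinct-terminals⇒nonclashing (proj₂ (three-terminal c∈ψ))

  ψ-≈ᶜ : ∀ {c a b e} → c ∈ ψ → a ∈ c → b ∈ c → e ∈ c →
         proj₁ a ≢ proj₁ b → proj₁ a ≢ proj₁ e → proj₁ b ≢ proj₁ e → c ≈ᶜ (a ∷ b ∷ e ∷ [])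
  ψ-≈ᶜ c∈ψ a∈c b∈c e∈c a≢b a≢e b≢e =
    unique-⊆⇒≈ᶜ (Unique-map⁻ ((a≢b ∷ a≢e ∷ []) ∷ (b≢e ∷ []) ∷ [] ∷ []))
                (λ { (here refl) → a∈c ; (there (here refl)) → b∈c ; (there (there (here refl))) → e∈c })
                (≤-reflexive (proj₁ (three-terminal c∈ψ)))

  Initial : Clause → Set
  Initial E = ∃[ c ] c ∈ ψ × c ≈ᶜ E

  record Merged (E : Clause) : Set where
    field
      c d        : Clause
      c∈ψ        : c ∈ ψ
      d∈ψ        : d ∈ ψ
      t          : Terminal
      s          : Bool
      u Y Z      : Term
      original-u : Original (proj₁ u)
      fresh-Y    : Fresh Y
      fresh-Z    : Fresh Z
      c≈         : c ≈ᶜ ((t , s) ∷ u ∷ Y ∷ [])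
      d≈         : d ≈ᶜ ((t , not s) ∷ u ∷ Z ∷ [])
      E≈         : E ≈ᶜ (u ∷ Y ∷ Z ∷ [])

    u∈c : u ∈ c
    u∈c = ≈ᶜ⇒⊇ c≈ (there (here refl))

    u∈d : u ∈ d
    u∈d = ≈ᶜ⇒⊇ d≈ (there (here refl))

    Y∈c : Y ∈ c
    Y∈c = ≈ᶜ⇒⊇ c≈ (there (there (here refl)))

    Z∈d : Z ∈ d
    Z∈d = ≈ᶜ⇒⊇ d≈ (there (there (here refl)))

    terminal-Y≢Z : proj₁ Y ≢ proj₁ Z
    terminal-Y≢Z Y≡Z with proj₂ Y ≟ᴮ proj₂ Z
    ... | yes sY≡sZ =
      ψ-nonclashing d∈ψ (subst ((t , s) ∈_) c≡d (≈ᶜ⇒⊇ c≈ (here refl))) (≈ᶜ⇒⊇ d≈ (here refl))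
      where
      c≡d : c ≡ d
      c≡d = fresh-home-unique c∈ψ d∈ψ fresh-Y Y∈c (subst (_∈ d) (sym (cong₂ _,_ Y≡Z sY≡sZ)) Z∈d)
    ... | no sY≢sZ = siblings-disjoint c∈ψ d∈ψ fresh-Y Y∈c Ȳ∈d u∈c original-u (occurs u∈d)
      where
      Ȳ∈d : (proj₁ Y , not (proj₂ Y)) ∈ d
      Ȳ∈d = subst (_∈ d) (cong₂ _,_ (sym Y≡Z) (¬-not (≢-sym sY≢sZ))) Z∈d

    three-terminals : ThreeTerminals E
    three-terminals = u , Y , Z , E≈ ,
      (original≢fresh original-u fresh-Y ∷ original≢fresh original-u fresh-Z ∷ []) ∷
      (terminal-Y≢Z ∷ []) ∷ [] ∷ []

    fresh⇒Y⊎Z : ∀ {W} → W ∈ E → Fresh W → W ≡ Y ⊎ W ≡ Z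
    fresh⇒Y⊎Z W∈E fW with ≈ᶜ⇒⊆ E≈ W∈E
    ... | here refl                 = ⊥-elim (fW original-u)
    ... | there (here refl)         = inj₁ refl
    ... | there (there (here refl)) = inj₂ refl

    original⇒u : ∀ {o} → o ∈ E → Original (proj₁ o) → o ≡ u
    original⇒u o∈E oo with ≈ᶜ⇒⊆ E≈ o∈E
    ... | here refl                 = refl
    ... | there (here refl)         = ⊥-elim (fresh-Y oo)
    ... | there (there (here refl)) = ⊥-elim (fresh-Z oo)

    home⇒c⊎d : ∀ {W h} → W ∈ E → Fresh W → Home W h → h ≡ c ⊎ h ≡ d
    home⇒c⊎d W∈E fW (h∈ψ , W∈h) with fresh⇒Y⊎Z W∈E fW
    ... | inj₁ refl = inj₁ (fresh-home-unique h∈ψ c∈ψ fresh-Y W∈h Y∈c)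
    ... | inj₂ refl = inj₂ (fresh-home-unique h∈ψ d∈ψ fresh-Z W∈h Z∈d)

    terminals-c⊆d : ∀ {v} → v ∈ c → Original (proj₁ v) → OccursIn (proj₁ v) d
    terminals-c⊆d v∈c ov with ≈ᶜ⇒⊆ c≈ v∈c
    ... | here refl                 = occurs (≈ᶜ⇒⊇ d≈ (here refl))
    ... | there (here refl)         = occurs u∈d
    ... | there (there (here refl)) = ⊥-elim (fresh-Y ov)

    terminals-d⊆c : ∀ {v} → v ∈ d → Original (proj₁ v) → OccursIn (proj₁ v) c
    terminals-d⊆c v∈d ov with ≈ᶜ⇒⊆ d≈ v∈d
    ... | here refl                 = occurs (≈ᶜ⇒⊇ c≈ (here refl))
    ... | there (here refl)         = occurs u∈c
    ... | there (there (here refl)) = ⊥-elim (fresh-Z ov)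

  FirstRound : Clause → Set
  FirstRound E = Initial E ⊎ Merged E

  FirstRound⇒ThreeTerminals : ∀ {E} → FirstRound E → ThreeTerminals E
  FirstRound⇒ThreeTerminals (inj₁ (c , c∈ψ , c≈E)) = ThreeTerminals-≈ᶜ c≈E (ψ-ThreeTerminals c∈ψ)
  FirstRound⇒ThreeTerminals (inj₂ M)               = Merged.three-terminals M

  fresh-has-home : ∀ {E W} → FirstRound E → W ∈ E → Fresh W → ∃[ h ] Home W h
  fresh-has-home (inj₁ (c , c∈ψ , c≈E)) W∈E _ = c , c∈ψ , ≈ᶜ⇒⊇ c≈E W∈E
  fresh-has-home (inj₂ M) W∈E fW with Merged.fresh⇒Y⊎Z M W∈E fW
  ... | inj₁ refl = Merged.c M , Merged.c∈ψ M , Merged.Y∈c M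
  ... | inj₂ refl = Merged.d M , Merged.d∈ψ M , Merged.Z∈d M

  originals-at-home : ∀ {E W h o} → FirstRound E → W ∈ E → Fresh W → Home W h →
                      o ∈ E → Original (proj₁ o) → o ∈ h
  originals-at-home (inj₁ (c , c∈ψ , c≈E)) W∈E fW (h∈ψ , W∈h) o∈E _ =
    subst (_ ∈_) (fresh-home-unique c∈ψ h∈ψ fW (≈ᶜ⇒⊇ c≈E W∈E) W∈h) (≈ᶜ⇒⊇ c≈E o∈E)
  originals-at-home (inj₂ M) W∈E fW home o∈E oo
    with Merged.original⇒u M o∈E oo | Merged.home⇒c⊎d M W∈E fW home
  ... | refl | inj₁ refl = Merged.u∈c M
  ... | refl | inj₂ refl = Merged.u∈d M

  homes-agree : ∀ {E W W′ h h′ v} → FirstRound E → W ∈ E → W′ ∈ E → Fresh W → Fresh W′ →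
                Home W h → Home W′ h′ → v ∈ h → Original (proj₁ v) → OccursIn (proj₁ v) h′
  homes-agree (inj₁ (c , c∈ψ , c≈E)) W∈E W′∈E fW fW′ (h∈ψ , W∈h) (h′∈ψ , W′∈h′) v∈h _ =
    occurs (subst (_ ∈_) (trans (fresh-home-unique h∈ψ c∈ψ fW W∈h (≈ᶜ⇒⊇ c≈E W∈E))
                                (fresh-home-unique c∈ψ h′∈ψ fW′ (≈ᶜ⇒⊇ c≈E W′∈E) W′∈h′)) v∈h)
  homes-agree (inj₂ M) W∈E W′∈E fW fW′ home home′ v∈h ov
    with Merged.home⇒c⊎d M W∈E fW home | Merged.home⇒c⊎d M W′∈E fW′ home′
  ... | inj₁ refl | inj₁ refl = occurs v∈h
  ... | inj₁ refl | inj₂ refl = Merged.terminals-c⊆d M v∈h ov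
  ... | inj₂ refl | inj₁ refl = Merged.terminals-d⊆c M v∈h ov
  ... | inj₂ refl | inj₂ refl = occurs v∈h

  clash-through-fresh : ∀ {D W h p σ} → FirstRound D → Home W h → Fresh W → (p , σ) ∈ h → Original p →
                        W ∈ D → (p , not σ) ∈ D → ⊥
  clash-through-fresh R home fW p∈h op W∈D p̄∈D =
    ψ-nonclashing (proj₁ home) p∈h (originals-at-home R W∈D fW home p̄∈D op)

  fresh-pivot-isolates : ∀ {D c p σ v} → FirstRound D → c ∈ ψ → (p , σ) ∈ c → ¬ Original p →
                         v ∈ c → Original (proj₁ v) → (p , not σ) ∈ D →
                         (∀ {h} → Home (p , not σ) h → OccursIn (proj₁ v) h) → ⊥
  fresh-pivot-isolates R c∈ψ p∈c fp v∈c ov p̄∈D reaches with fresh-has-home R p̄∈D fp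
  ... | h , home@(h∈ψ , p̄∈h) = siblings-disjoint c∈ψ h∈ψ fp p∈c p̄∈h v∈c ov (reaches home)

  -- A fresh term of a round-1 clause lies in a single clause of ψ, which holds all the original
  -- terms of the round-1 clause; so a common term would put the clash inside one clause of ψ,
  -- or give two siblings a common original terminal.
  module _ {C D} (M : Merged C) (R : FirstRound D) where
    open Merged M

    merged-clash⇒disjoint : ∀ {p σ w} → (p , σ) ∈ C → (p , not σ) ∈ D →
                            w ∈ C → w ∈ D → proj₁ w ≢ p → ⊥
    merged-clash⇒disjoint p∈C p̄∈D w∈C w∈D w≢p with ≈ᶜ⇒⊆ E≈ p∈C | ≈ᶜ⇒⊆ E≈ w∈C
    ... | here refl | here refl = w≢p refl
    ... | here refl | there (here refl) =
      clash-through-fresh R (c∈ψ , Y∈c) fresh-Y u∈c original-u w∈D p̄∈D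
    ... | here refl | there (there (here refl)) =
      clash-through-fresh R (d∈ψ , Z∈d) fresh-Z u∈d original-u w∈D p̄∈D
    ... | there (here refl) | here refl =
      fresh-pivot-isolates R c∈ψ Y∈c fresh-Y u∈c original-u p̄∈D
        (λ home → occurs (originals-at-home R p̄∈D fresh-Y home w∈D original-u))
    ... | there (here refl) | there (here refl) = w≢p refl
    ... | there (here refl) | there (there (here refl)) =
      fresh-pivot-isolates R c∈ψ Y∈c fresh-Y u∈c original-u p̄∈D
        (λ home → homes-agree R w∈D p̄∈D fresh-Z fresh-Y (d∈ψ , Z∈d) home u∈d original-u)
    ... | there (there (here refl)) | here refl =
      fresh-pivot-isolates R d∈ψ Z∈d fresh-Z u∈d original-u p̄∈D
        (λ home → occurs (originals-at-home R p̄∈D fresh-Z home w∈D original-u))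
    ... | there (there (here refl)) | there (here refl) =
      fresh-pivot-isolates R d∈ψ Z∈d fresh-Z u∈d original-u p̄∈D
        (λ home → homes-agree R w∈D p̄∈D fresh-Y fresh-Z (c∈ψ , Y∈c) home u∈c original-u)
    ... | there (there (here refl)) | there (there (here refl)) = w≢p refl

  merged-resolvent : ∀ {c d E} → c ∈ ψ → d ∈ ψ → (res : Resolvent c d E) → ∀ {w} → w ∈ c → w ∈ d →
                     proj₁ w ≢ proj₁ res → Original (proj₁ w) → Original (proj₁ res) → Merged E
  merged-resolvent {c} {d} {E} c∈ψ d∈ψ res@(p , σ , p∈c , p̄∈d , _) {w} w∈c w∈d w≢p ow op
    with fresh-member c∈ψ | fresh-member d∈ψ
  ... | Y , Y∈c , fY | Z , Z∈d , fZ = record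
    { c = c ; d = d ; c∈ψ = c∈ψ ; d∈ψ = d∈ψ ; t = p ; s = σ ; u = w ; Y = Y ; Z = Z
    ; original-u = ow ; fresh-Y = fY ; fresh-Z = fZ ; c≈ = c≈ ; d≈ = d≈ ; E≈ = λ _ → mk⇔ to from }
    where
    c≈ : c ≈ᶜ ((p , σ) ∷ w ∷ Y ∷ [])
    c≈ = ψ-≈ᶜ c∈ψ p∈c w∈c Y∈c (≢-sym w≢p) (original≢fresh op fY) (original≢fresh ow fY)

    d≈ : d ≈ᶜ ((p , not σ) ∷ w ∷ Z ∷ [])
    d≈ = ψ-≈ᶜ d∈ψ p̄∈d w∈d Z∈d (≢-sym w≢p) (original≢fresh op fZ) (original≢fresh ow fZ)

    to : ∀ {v} → v ∈ E → v ∈ w ∷ Y ∷ Z ∷ []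
    to v∈E with resolvent⊆ res v∈E
    ... | inj₁ v∈c , v≢p with ≈ᶜ⇒⊆ c≈ v∈c
    ...   | here refl                 = ⊥-elim (v≢p refl)
    ...   | there (here refl)         = here refl
    ...   | there (there (here refl)) = there (here refl)
    to v∈E | inj₂ v∈d , v≢p with ≈ᶜ⇒⊆ d≈ v∈d
    ...   | here refl                 = ⊥-elim (v≢p refl)
    ...   | there (here refl)         = here refl
    ...   | there (there (here refl)) = there (there (here refl))

    from : ∀ {v} → v ∈ w ∷ Y ∷ Z ∷ [] → v ∈ E
    from (here refl)                 = resolvent⊇ res (inj₁ w∈c) w≢p
    from (there (here refl))         = resolvent⊇ res (inj₁ Y∈c) (≢-sym (original≢fresh op fY))
    from (there (there (here refl))) = resolvent⊇ res (inj₂ Z∈d) (≢-sym (original≢fresh op fZ))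

  ψ-resolvent⇒Merged : ∀ {c d E} → c ∈ ψ → d ∈ ψ → Resolvent c d E → length E ≤ 3 → Merged E
  ψ-resolvent⇒Merged c∈ψ d∈ψ res@(p , σ , p∈c , p̄∈d , _) short
    with short-resolvent⇒common-term (ψ-ThreeTerminals c∈ψ) (ψ-ThreeTerminals d∈ψ) res short
  ... | w , w∈c , w∈d , w≢p with original? (proj₁ w) | original? p
  ... | no fw | _ =
    ⊥-elim (ψ-nonclashing d∈ψ (subst ((p , σ) ∈_) (fresh-home-unique c∈ψ d∈ψ fw w∈c w∈d) p∈c) p̄∈d)
  ... | yes ow | no fp = ⊥-elim (siblings-disjoint c∈ψ d∈ψ fp p∈c p̄∈d w∈c ow (occurs w∈d))
  ... | yes ow | yes op = merged-resolvent c∈ψ d∈ψ res w∈c w∈d w≢p ow op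

  Round₀⇒Initial : ∀ {E} → Round ψ 0 E → Initial E
  Round₀⇒Initial (_ , c≈E) = find c≈E

  Initial⇒Round₀ : ∀ {E} → Initial E → WF E → Round ψ 0 E
  Initial⇒Round₀ (c , c∈ψ , c≈E) wf = wf , lose c∈ψ c≈E

  round₁-view : ∀ {E} → Round ψ 1 E → FirstRound E
  round₁-view (inj₁ E₀) = inj₁ (Round₀⇒Initial E₀)
  round₁-view (inj₂ (_ , short , inj₁ (C , D , C₀ , _ , D₀ , _ , res)))
    with Round₀⇒Initial C₀ | Round₀⇒Initial D₀
  ... | c , c∈ψ , c≈C | d , d∈ψ , d≈D =
    inj₂ (ψ-resolvent⇒Merged c∈ψ d∈ψ (Resolvent-≈ᶜ-parents c≈C d≈D res) short)
  round₁-view (inj₂ (_ , short , inj₂ (C , C₀ , _ , exp))) with Round₀⇒Initial C₀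
  ... | c , c∈ψ , c≈C =
    inj₁ (c , c∈ψ , ≈ᶜ-trans c≈C (expansion-trivial three exp short))
    where
    three : ThreeTerminals C
    three = ThreeTerminals-≈ᶜ c≈C (ψ-ThreeTerminals c∈ψ)

  short-resolvent⇒Initial : ∀ {C D E} → FirstRound C → FirstRound D → Resolvent C D E → length E ≤ 3 →
                            Initial C × Initial D
  short-resolvent⇒Initial {C} RC RD res@(p , σ , p∈C , p̄∈D , _) short
    with short-resolvent⇒common-term (FirstRound⇒ThreeTerminals RC) (FirstRound⇒ThreeTerminals RD) res short
  ... | w , w∈C , w∈D , w≢p =
    unmerged RC (λ M → merged-clash⇒disjoint M RD p∈C p̄∈D w∈C w∈D w≢p) ,
    unmerged RD (λ M → merged-clash⇒disjoint M RC p̄∈D p̿∈C w∈D w∈C w≢p)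
    where
    p̿∈C : (p , not (not σ)) ∈ C
    p̿∈C = subst (λ b → (p , b) ∈ C) (sym (not-involutive σ)) p∈C

    unmerged : ∀ {E} → FirstRound E → ¬ Merged E → Initial E
    unmerged (inj₁ initial) _ = initial
    unmerged (inj₂ M) ¬M = ⊥-elim (¬M M)

  round₂⊆round₁ : ∀ {E} → Round ψ 2 E → Round ψ 1 E
  round₂⊆round₁ (inj₁ E₁) = E₁
  round₂⊆round₁ (inj₂ (wf , short , inj₁ (C , D , C₁ , lC , D₁ , lD , res)))
    with short-resolvent⇒Initial (round₁-view C₁) (round₁-view D₁) res short
  ... | iC , iD = inj₂ (wf , short , inj₁ (C , D , Initial⇒Round₀ iC (Round⇒WF 1 C₁) , lC ,
                                                   Initial⇒Round₀ iD (Round⇒WF 1 D₁) , lD , res))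
  round₂⊆round₁ (inj₂ (wf , short , inj₂ (C , C₁ , _ , exp))) =
    Round-≈ᶜ 1 C₁ (expansion-trivial (FirstRound⇒ThreeTerminals (round₁-view C₁)) exp short) wf short

  round₁-consistent : ¬ Contradictory (Round ψ 1)
  round₁-consistent (_ , unit , _) = ¬ThreeTerminals-unit (FirstRound⇒ThreeTerminals (round₁-view unit))

  quigley-satisfiable : QuigleyOutputsSatisfiable ψ
  quigley-satisfiable = 1 , (λ _ → round₂⊆round₁) , consistent
    where
    consistent : ∀ r → r ≤ 1 → ¬ Contradictory (Round ψ (suc r))
    consistent zero          _ = round₁-consistent
    consistent (suc zero)    _ (t , pos , neg) =
      round₁-consistent (t , round₂⊆round₁ pos , round₂⊆round₁ neg)
    consistent (suc (suc _)) (s≤s ())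

half : ℕ → Bool → Clause → Clause
half h true  c = take h c
half h false c = drop h c

half-⊆ : ∀ h s c → half h s c ⊆ c
half-⊆ h true  c u∈ = subst (_ ∈_) (take++drop≡id h c) (xs⊆xs++ys (take h c) (drop h c) u∈)
half-⊆ h false c u∈ = subst (_ ∈_) (take++drop≡id h c) (xs⊆ys++xs (drop h c) (take h c) u∈)

length-half : ∀ h s {c} → length c ≡ h + h → length (half h s c) ≡ h
length-half h true  {c} len = trans (length-take h c) (trans (cong (h ⊓_) len) (m≤n⇒m⊓n≡m (m≤m+n h h)))
length-half h false {c} len = trans (length-drop h c) (trans (cong (_∸ h) len) (m+n∸m≡n h h))

half-distinct : ∀ h s {c} → DistinctTerminals c → DistinctTerminals (half h s c)
half-distinct h true  {c} dist = subst Unique (take-map h c) (take⁺ h dist)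
half-distinct h false {c} dist = subst Unique (drop-map h c) (drop⁺ h dist)

take-drop-disjoint : ∀ h {c v w} → DistinctTerminals c → v ∈ take h c → w ∈ drop h c → proj₁ v ≢ proj₁ w
take-drop-disjoint (suc h) {a ∷ c} (a≢c ∷ _) (here refl) w∈ =
  All.lookup a≢c (∈-map⁺ proj₁ (half-⊆ h false c w∈))
take-drop-disjoint (suc h) {a ∷ c} (_ ∷ dist) (there v∈) w∈ = take-drop-disjoint h dist v∈ w∈

halves-disjoint : ∀ h s {c v w} → DistinctTerminals c →
                  v ∈ half h s c → w ∈ half h (not s) c → proj₁ v ≢ proj₁ w
halves-disjoint h true  dist v∈ w∈ = take-drop-disjoint h dist v∈ w∈
halves-disjoint h false dist v∈ w∈ = ≢-sym (take-drop-disjoint h dist w∈ v∈)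

snoc-distinct : ∀ {c y} s → DistinctTerminals c → ¬ OccursIn y c → DistinctTerminals (c ++ [ (y , s) ])
snoc-distinct {c} {y} s dist y∉c =
  subst Unique (sym (map-++ proj₁ c [ (y , s) ]))
        (++⁺ dist ([] ∷ []) λ { (y∈c , here refl) → y∉c (Any-map⁻ y∈c) })

splitAllFrom-suc : ∀ h i x φ → splitAllFrom h (suc i) x φ ≡ splitAllFrom h i (λ n → x (suc n)) φ
splitAllFrom-suc h i x []      = refl
splitAllFrom-suc h i x (c ∷ φ) = cong (splitClause h (x (suc i)) c ++_) (splitAllFrom-suc h (suc i) x φ)

∈-splitAll⁻ : ∀ h x φ {c} → c ∈ splitAllFrom h 0 x φ →
              ∃[ n ] ∃[ s ] c ≡ half h s (lookup φ n) ++ [ (x (toℕ n) , s) ]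
∈-splitAll⁻ h x (c₀ ∷ φ) (here refl)         = zero , true , refl
∈-splitAll⁻ h x (c₀ ∷ φ) (there (here refl)) = zero , false , refl
∈-splitAll⁻ h x (c₀ ∷ φ) (there (there c∈))
  with ∈-splitAll⁻ h (λ n → x (suc n)) φ (subst (_ ∈_) (splitAllFrom-suc h 0 x φ) c∈)
... | n , s , refl = suc n , s , refl

FreshFor : CNF → (ℕ → Terminal) → Set
FreshFor φ x = ∀ i → i < length φ → ¬ OccursInCNF (x i) φ

InjectiveOn : CNF → (ℕ → Terminal) → Set
InjectiveOn φ x = ∀ i i′ → i < length φ → i′ < length φ → x i ≡ x i′ → i ≡ i′

split-length : ∀ h x {φ} → All (λ c → length c ≡ h + h) φ →
               All (λ c → length c ≡ h + 1) (splitAllFrom h 0 x φ)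
split-length h x {φ} lengths = All.tabulate member-length
  where
  member-length : ∀ {c} → c ∈ splitAllFrom h 0 x φ → length c ≡ h + 1
  member-length c∈ with ∈-splitAll⁻ h x φ c∈
  ... | n , s , refl = trans (length-++ (half h s (lookup φ n)))
                             (cong (_+ 1) (length-half h s (All.lookup lengths (∈-lookup n))))

split-distinct : ∀ h x {φ} → FreshFor φ x → All DistinctTerminals φ →
                 All DistinctTerminals (splitAllFrom h 0 x φ)
split-distinct h x {φ} fresh distinct = All.tabulate member-distinct
  where
  member-distinct : ∀ {c} → c ∈ splitAllFrom h 0 x φ → DistinctTerminals c
  member-distinct c∈ with ∈-splitAll⁻ h x φ c∈
  ... | n , s , refl = snoc-distinct s (half-distinct h s (All.lookup distinct (∈-lookup n)))
    (λ occ → fresh (toℕ n) (toℕ<n n) (lose (∈-lookup n) (Any-resp-⊆ (half-⊆ h s (lookup φ n)) occ)))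

b-suc : ∀ j → b (suc j) ≡ suc (2 ^ j) + suc (2 ^ j)
b-suc j = lemma (2 ^ j)
  where
  lemma : ∀ m → 2 * m + 2 ≡ suc m + suc m
  lemma = solve-∀

b-half : ∀ j → b (suc j) / 2 ≡ suc (2 ^ j)
b-half j = trans (cong (_/ 2) (lemma (2 ^ j))) (m*n/n≡m (suc (2 ^ j)) 2)
  where
  lemma : ∀ m → 2 * m + 2 ≡ suc m * 2
  lemma = solve-∀

b-pred : ∀ j → suc (2 ^ j) + 1 ≡ b j
b-pred j = sym (+-suc (2 ^ j) 1)

step-invariants : ∀ j {φ φ′} → Step (suc j) φ φ′ →
                  All (λ c → length c ≡ b (suc j)) φ → All DistinctTerminals φ →
                  All (λ c → length c ≡ b j) φ′ × All DistinctTerminals φ′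
step-invariants j (x , fresh , _ , refl) lengths distinct =
  All.map (λ len → trans len h+1≡b) (split-length h x (All.map (λ len → trans len b≡h+h) lengths)) ,
  split-distinct h x fresh distinct
  where
  h : ℕ
  h = b (suc j) / 2
  b≡h+h : b (suc j) ≡ h + h
  b≡h+h = trans (b-suc j) (sym (cong₂ _+_ (b-half j) (b-half j)))
  h+1≡b : h + 1 ≡ b j
  h+1≡b = trans (cong (_+ 1) (b-half j)) (b-pred j)

last-step : ∀ j {φ ψ} → Chain (suc j) φ ψ → All (λ c → length c ≡ b (suc j)) φ → All DistinctTerminals φ →
            ∃[ φ₁ ] Step 1 φ₁ ψ × All (λ c → length c ≡ 4) φ₁ × All DistinctTerminals φ₁
last-step zero    {φ} (_ , step , refl) lengths distinct = φ , step , lengths , distinct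
last-step (suc j) (_ , step , chain) lengths distinct =
  let lengths′ , distinct′ = step-invariants (suc j) step lengths distinct
  in last-step j chain lengths′ distinct′

SatisfiedBy : (ℕ → Bool) → Clause → Set
SatisfiedBy σ c = Any (λ u → σ (proj₁ u) ≡ proj₂ u) c

satisfies-split⁻ : ∀ σ h y c → SatisfiedBy σ (take h c ++ [ (y , true) ]) →
                   SatisfiedBy σ (drop h c ++ [ (y , false) ]) → SatisfiedBy σ c
satisfies-split⁻ σ h y c left right with ++⁻ (take h c) left | ++⁻ (drop h c) right
... | inj₁ in-take | _                    = Any-resp-⊆ (half-⊆ h true c) in-take
... | inj₂ _       | inj₁ in-drop         = Any-resp-⊆ (half-⊆ h false c) in-drop
... | inj₂ (here y-true) | inj₂ (here y-false) with trans (sym y-true) y-false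
... | ()

satisfies-splitAll⁻ : ∀ σ h i x φ → Satisfies σ (splitAllFrom h i x φ) → Satisfies σ φ
satisfies-splitAll⁻ σ h i x []      _                      = []
satisfies-splitAll⁻ σ h i x (c ∷ φ) (left ∷ right ∷ rest) =
  satisfies-split⁻ σ h (x i) c left right ∷ satisfies-splitAll⁻ σ h (suc i) x φ rest

Chain-unsatisfiable : ∀ k {φ ψ} → Chain k φ ψ → Unsatisfiable φ → Unsatisfiable ψ
Chain-unsatisfiable zero    refl unsat = unsat
Chain-unsatisfiable (suc j) {φ} (_ , (x , _ , _ , refl) , chain) unsat =
  Chain-unsatisfiable j chain (λ σ sat → unsat σ (satisfies-splitAll⁻ σ _ 0 x φ sat))

module LastSplit {φ : CNF} {x : ℕ → Terminal} (fresh : FreshFor φ x) (injective : InjectiveOn φ x)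
                 (lengths : All (λ c → length c ≡ 4) φ) (distinct : All DistinctTerminals φ) where

  ψ : CNF
  ψ = splitAllFrom 2 0 x φ

  Original : Terminal → Set
  Original t = OccursInCNF t φ

  original? : Decidable Original
  original? t = any? (any? (λ u → t ℕ.≟ proj₁ u)) φ

  half-original : ∀ n s {v} → v ∈ half 2 s (lookup φ n) → Original (proj₁ v)
  half-original n s v∈ = lose (∈-lookup n) (occurs (half-⊆ 2 s (lookup φ n) v∈))

  x-fresh : ∀ n → ¬ Original (x (toℕ n))
  x-fresh n = fresh (toℕ n) (toℕ<n n)

  x-injective : ∀ {n n′} → x (toℕ n) ≡ x (toℕ n′) → n ≡ n′
  x-injective e = toℕ-injective (injective _ _ (toℕ<n _) (toℕ<n _) e)

  fresh⇒x : ∀ n s {W} → W ∈ half 2 s (lookup φ n) ++ [ (x (toℕ n) , s) ] → ¬ Original (proj₁ W) →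
            W ≡ (x (toℕ n) , s)
  fresh⇒x n s W∈ fW with ++⁻ (half 2 s (lookup φ n)) W∈
  ... | inj₁ W∈half      = ⊥-elim (fW (half-original n s W∈half))
  ... | inj₂ (here refl) = refl

  three-terminal : ∀ {c} → c ∈ ψ → length c ≡ 3 × DistinctTerminals c
  three-terminal c∈ψ =
    All.lookup (split-length 2 x lengths) c∈ψ , All.lookup (split-distinct 2 x fresh distinct) c∈ψ

  fresh-member : ∀ {c} → c ∈ ψ → ∃[ Y ] Y ∈ c × ¬ Original (proj₁ Y)
  fresh-member c∈ψ with ∈-splitAll⁻ 2 x φ c∈ψ
  ... | n , s , refl = (x (toℕ n) , s) , xs⊆ys++xs _ (half 2 s (lookup φ n)) (here refl) , x-fresh n

  fresh-home-unique : ∀ {c d Y} → c ∈ ψ → d ∈ ψ → ¬ Original (proj₁ Y) → Y ∈ c → Y ∈ d → c ≡ d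
  fresh-home-unique c∈ψ d∈ψ fY Y∈c Y∈d with ∈-splitAll⁻ 2 x φ c∈ψ | ∈-splitAll⁻ 2 x φ d∈ψ
  ... | n , s , refl | n′ , s′ , refl with fresh⇒x n s Y∈c fY | fresh⇒x n′ s′ Y∈d fY
  ... | refl | e with x-injective (cong proj₁ e) | cong proj₂ e
  ... | refl | refl = refl

  siblings-disjoint : ∀ {c d t σ v} → c ∈ ψ → d ∈ ψ → ¬ Original t → (t , σ) ∈ c → (t , not σ) ∈ d →
                      v ∈ c → Original (proj₁ v) → ¬ OccursIn (proj₁ v) d
  siblings-disjoint c∈ψ d∈ψ ft t∈c t̄∈d v∈c ov v∼d
    with ∈-splitAll⁻ 2 x φ c∈ψ | ∈-splitAll⁻ 2 x φ d∈ψ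
  ... | n , s , refl | n′ , s′ , refl with fresh⇒x n s t∈c ft | fresh⇒x n′ s′ t̄∈d ft
  ... | refl | e with x-injective (cong proj₁ e) | cong proj₂ e
  ... | refl | refl with find v∼d | ++⁻ (half 2 s (lookup φ n)) v∈c
  ... | _ , _ , _ | inj₂ (here refl) = ft ov
  ... | _ , v′∈d , v≡v′ | inj₁ v∈half with ++⁻ (half 2 (not s) (lookup φ n)) v′∈d
  ...   | inj₁ v′∈half     = halves-disjoint 2 s (All.lookup distinct (∈-lookup n)) v∈half v′∈half v≡v′
  ...   | inj₂ (here refl) = ft (subst Original v≡v′ ov)

  open QuigleyOnSplitClauses ψ Original original? three-terminal fresh-member fresh-home-unique siblings-disjoint
    public using (quigley-satisfiable)

last-split-satisfiable : ∀ {φ₁ ψ} → Step 1 φ₁ ψ → All (λ c → length c ≡ 4) φ₁ → All DistinctTerminals φ₁ →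
                         QuigleyOutputsSatisfiable ψ
last-split-satisfiable (_ , fresh , injective , refl) lengths distinct =
  LastSplit.quigley-satisfiable fresh injective lengths distinct

mainTheorem4 : (k : ℕ) → 1 ≤ k → (φ : CNF) →
    Unsatisfiable φ →
    All (λ c → length c ≡ b k) φ →
    All (λ c → Unique (map proj₁ c)) φ →
    (ψ : CNF) → Chain k φ ψ →
    QuigleyOutputsSatisfiable ψ × Unsatisfiable ψ
mainTheorem4 zero    () _ _ _ _ _ _
mainTheorem4 (suc j) _ _ unsat lengths distinct _ chain =
  let φ₁ , step , lengths₁ , distinct₁ = last-step j chain lengths distinct
  in last-split-satisfiable step lengths₁ distinct₁ , Chain-unsatisfiable (suc j) chain unsat
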